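{- Let $\mathcal{M}$ be a finite unitary magma and $m:=\#\mathcal{M}$. The Hilbert series $\mathcal{H}(t):=\sum_{n\ge1}\dim\mathrm{NC}\mathcal{M}(n)\,t^n$ of $\mathrm{NC}\mathcal{M}$ satisfies $$t+(m^3-2m^2+2m-1)t^2+(2m^2t-3mt+2t-1)\mathcal{H}(t)+(m-1)\mathcal{H}(t)^2=0.$$
   Context: A unitary magma $\mathcal{M}$ is a set with binary operation $\star$ and two-sided unit $1_\mathcal{M}$. For $n\ge1$, an $\mathcal{M}$-clique of arity $n$ labels each arc $(x,y)$, $1\le x<y\le n+1$, of a polygon with vertices $1,\dots,n+1$ by an element of $\mathcal{M}$; base $(1,n+1)$, edges $(i,i+1)$, other arcs diagonals; there is a unique $\mathcal{M}$-clique of arity 1. Solid arc: label $\neq1_\mathcal{M}$; noncrossing: no two solid diagonals $(x,y),(x',y')$ with $x<x'<y<y'$ or $x'<x<y'<y$. $\mathrm{NC}\mathcal{M}(n)$ is the vector space (over a field $\mathbb{K}$ of characteristic zero) with basis the noncrossing $\mathcal{M}$-cliques of arity $n$ (these spaces form the operad $\mathrm{NC}\mathcal{M}$). -}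

module Defs where

open import Data.Nat as ℕ using (ℕ; zero; suc; _∸_; _≡ᵇ_; _<ᵇ_)
open import Data.Integer as ℤ using (ℤ; +_)
open import Data.Fin using (Fin)
open import Data.Fin.Properties using () renaming (_≟_ to _≟Fin_)
open import Data.Bool using (Bool; true; false; not; _∧_; _∨_)
open import Data.Product using (_×_; _,_; proj₁)
open import Data.List as List using (List; []; _∷_; map; concatMap; upTo; allFin; length; filterᵇ; zip)
open import Data.Bool.ListAction using (all)
open import Data.Vec as Vec using (Vec)
open import Function.Bundles using (_↔_; Inverse)
open import Algebra.Structures using (IsUnitalMagma)
open import Relation.Binary.PropositionalEquality using (_≡_)
open import Relation.Nullary.Decidable using (does)

-- Finite unitary magmas (equality is propositional equality; finiteness
-- is an explicit bijection with Fin card, so #M = card).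

record FiniteUnitaryMagma : Set₁ where
  field
    Carrier       : Set
    _⋆_           : Carrier → Carrier → Carrier
    𝟙             : Carrier
    isUnitalMagma : IsUnitalMagma _≡_ _⋆_ 𝟙
    card          : ℕ
    enumeration   : Carrier ↔ Fin card

  isUnit : Carrier → Bool
  isUnit c = does (Inverse.to enumeration c ≟Fin Inverse.to enumeration 𝟙)

  elements : List Carrier
  elements = map (Inverse.from enumeration) (allFin card)

range : ℕ → ℕ → List ℕ
range a b = map (a ℕ.+_) (upTo (suc b ∸ a))

Arc : Set
Arc = ℕ × ℕ

arcs : ℕ → List Arc
arcs n = concatMap (λ x → map (x ,_) (range (suc x) (suc n))) (range 1 (suc n))

isDiagonal : ℕ → Arc → Bool
isDiagonal n (x , y) = not (y ≡ᵇ suc x) ∧ not ((x ≡ᵇ 1) ∧ (y ≡ᵇ suc n))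

crosses : Arc → Arc → Bool
crosses (x , y) (x' , y') =
  ((x <ᵇ x') ∧ (x' <ᵇ y) ∧ (y <ᵇ y')) ∨ ((x' <ᵇ x) ∧ (x <ᵇ y') ∧ (y' <ᵇ y))

module _ (M : FiniteUnitaryMagma) where
  open FiniteUnitaryMagma M

  -- An M-clique of arity n: a label in M for each arc, listed in the order of 'arcs n'.
  Clique : ℕ → Set
  Clique n = Vec Carrier (length (arcs n))

  allVecs : (k : ℕ) → List (Vec Carrier k)
  allVecs zero    = Vec.[] ∷ []
  allVecs (suc k) = concatMap (λ c → map (c Vec.∷_) (allVecs k)) elements

  labelledArcs : (n : ℕ) → Clique n → List (Arc × Carrier)
  labelledArcs n c = zip (arcs n) (Vec.toList c)

  solidDiagonal : ℕ → Arc × Carrier → Bool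
  solidDiagonal n (a , l) = isDiagonal n a ∧ not (isUnit l)

  isNoncrossing : (n : ℕ) → Clique n → Bool
  isNoncrossing n c =
    all (λ p → all (λ q → not (solidDiagonal n p ∧ solidDiagonal n q ∧ crosses (proj₁ p) (proj₁ q)))
                   (labelledArcs n c))
        (labelledArcs n c)

  -- dim NC M (n) = number of noncrossing M-cliques of arity n
  -- By convention (see the paper) there is a unique M-clique of arity 1.
  dimNC : ℕ → ℕ
  dimNC 1 = 1
  dimNC n = length (filterᵇ (isNoncrossing n) (allVecs (length (arcs n))))

PowerSeries : Set
PowerSeries = ℕ → ℤ

const : ℤ → PowerSeries
const c zero    = c
const c (suc _) = + 0

t : PowerSeries
t 1 = + 1
t _ = + 0

infixl 6 _⊕_
infixl 7 _⊛_

_⊕_ : PowerSeries → PowerSeries → PowerSeries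
(f ⊕ g) n = f n ℤ.+ g n

_⊛_ : PowerSeries → PowerSeries → PowerSeries
(f ⊛ g) n = List.foldr ℤ._+_ (+ 0) (map (λ i → f i ℤ.* g (n ∸ i)) (upTo (suc n)))

hilbertSeries : FiniteUnitaryMagma → PowerSeries
hilbertSeries M zero    = + 0
hilbertSeries M (suc n) = + dimNC M (suc n)

{-# OPTIONS --safe #-}
-- Edges and base cross nothing, so dim NCM(n) is the number A(n+1) of ways to give every arc of
-- an (n+1)-gon either the unit or one of the m − 1 other labels so that the solid arcs are
-- pairwise noncrossing. In the polygon 0, …, k+1 the base (0, k+1) is free (a factor m); among the other
-- arcs from vertex 0, the longest solid one (0, i+1), if any, forces the arcs crossing it to the
-- unit and splits the rest into an (i+2)-gon without its base and a (k−i+1)-gon. Hence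
--   A(k+2) = m A(k+1) + (m − 1) Σ_{i<k} A(i+2) A(k+1−i),
-- and as H has coefficients 0, 1, m³ and A(n+1) for n ≥ 2, this recurrence is the functional
-- equation read coefficientwise.
module Submission where

open import Defs
open import Data.Nat using (ℕ)
open import Data.Bool using (Bool; true; false; not; _∧_; if_then_else_; T)
open import Data.Bool.Properties using (∧-assoc; ∧-comm; ∧-idem; ∧-identityʳ; ∧-zeroʳ; ∨-comm; ∨-zeroʳ; T-≡; T-∧)
open import Data.Bool.ListAction using (all)
open import Data.Product using (_×_; _,_; proj₁; Σ-syntax)
open import Data.List using (List; []; _∷_; _++_; [_]; _∷ʳ_; map)
open import Data.List.Properties using (map-++; map-∘; ++-assoc; ++-identityʳ)
open import Data.List.Relation.Unary.All as All using (All; []; _∷_)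
open import Data.List.Relation.Unary.All.Properties using (++⁺; map⁺)
open import Data.List.Relation.Binary.Permutation.Propositional as Perm using (_↭_; prep; swap; ↭-refl; ↭-reflexive)
import Data.List.Relation.Binary.Permutation.Propositional.Properties as Perm
open import Function using (_∘_; Equivalence)
open import Relation.Binary.PropositionalEquality hiding ([_])
open import Relation.Nullary using (contradiction)

module Noncrossing where
  open import Data.Nat
  open import Data.Nat.Properties
  open import Data.Nat.Tactic.RingSolver using (solve-∀)

  <ᵇ-true : ∀ {m n} → m < n → (m <ᵇ n) ≡ true
  <ᵇ-true = Equivalence.to T-≡ ∘ <⇒<ᵇ

  <ᵇ-false : ∀ {m n} → n ≤ m → (m <ᵇ n) ≡ false
  <ᵇ-false {m} {n} n≤m with m <ᵇ n in eq
  ... | false = refl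
  ... | true  = contradiction n≤m (<⇒≱ (<ᵇ⇒< m n (Equivalence.from T-≡ eq)))

  <ᵇ-irrefl : ∀ n → (n <ᵇ n) ≡ false
  <ᵇ-irrefl n = <ᵇ-false {n} ≤-refl

  crosses-sym : ∀ a b → crosses a b ≡ crosses b a
  crosses-sym (x , y) (x′ , y′) =
    ∨-comm ((x <ᵇ x′) ∧ (x′ <ᵇ y) ∧ (y <ᵇ y′)) ((x′ <ᵇ x) ∧ (x <ᵇ y′) ∧ (y′ <ᵇ y))

  crosses-irrefl : ∀ a → crosses a a ≡ false
  crosses-irrefl (x , y) rewrite <ᵇ-irrefl x = refl

  nested⇒¬crosses : ∀ {x y x′ y′} → x′ ≤ x → y ≤ y′ → crosses (x , y) (x′ , y′) ≡ false
  nested⇒¬crosses {x} {y} {x′} {y′} x′≤x y≤y′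
    rewrite <ᵇ-false {x} {x′} x′≤x | <ᵇ-false {y′} {y} y≤y′
    = trans (cong ((x′ <ᵇ x) ∧_) (∧-zeroʳ (x <ᵇ y′))) (∧-zeroʳ (x′ <ᵇ x))

  disjoint⇒¬crosses : ∀ {x y x′ y′} → x < y → y ≤ x′ → crosses (x , y) (x′ , y′) ≡ false
  disjoint⇒¬crosses {x} {y} {x′} {y′} x<y y≤x′
    rewrite <ᵇ-false {x′} {y} y≤x′ | <ᵇ-false {x′} {x} (≤-trans (<⇒≤ x<y) y≤x′)
          | ∧-zeroʳ (x <ᵇ x′) = refl

  interleaved⇒crosses : ∀ {x y x′ y′} → x′ < x → x < y′ → y′ < y → crosses (x , y) (x′ , y′) ≡ true
  interleaved⇒crosses x′<x x<y′ y′<y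
    rewrite <ᵇ-true x′<x | <ᵇ-true x<y′ | <ᵇ-true y′<y = ∨-zeroʳ _

  nothing-between-successors : ∀ m n → (m <ᵇ n) ∧ (n <ᵇ suc m) ≡ false
  nothing-between-successors zero    zero    = refl
  nothing-between-successors zero    (suc n) = refl
  nothing-between-successors (suc m) zero    = refl
  nothing-between-successors (suc m) (suc n) = nothing-between-successors m n

  edge⇒¬crosses : ∀ x b → crosses (x , suc x) b ≡ false
  edge⇒¬crosses x (x′ , y′)
    rewrite sym (∧-assoc (x <ᵇ x′) (x′ <ᵇ suc x) (suc x <ᵇ y′))
          | nothing-between-successors x x′ | nothing-between-successors x y′
    = ∧-zeroʳ (x′ <ᵇ x)

  compatible : Arc → List Arc → Bool
  compatible a = all (not ∘ crosses a)

  compatible-++ : ∀ a E F → compatible a (E ++ F) ≡ compatible a E ∧ compatible a F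
  compatible-++ a []      F = refl
  compatible-++ a (b ∷ E) F =
    trans (cong (not (crosses a b) ∧_) (compatible-++ a E F))
          (sym (∧-assoc (not (crosses a b)) (compatible a E) (compatible a F)))

  compatible-∷ʳ : ∀ b E a → compatible b (E ∷ʳ a) ≡ compatible b E ∧ not (crosses b a)
  compatible-∷ʳ b E a = trans (compatible-++ b E [ a ]) (cong (compatible b E ∧_) (∧-identityʳ _))

  compatible-∷ʳ-¬crosses : ∀ b E a → crosses b a ≡ false → compatible b (E ∷ʳ a) ≡ compatible b E
  compatible-∷ʳ-¬crosses b E a b∤a =
    trans (compatible-∷ʳ b E a) (trans (cong (λ c → compatible b E ∧ not c) b∤a) (∧-identityʳ _))

  compatible-∷ʳ-comm : ∀ b E x y → compatible b (E ∷ʳ x ∷ʳ y) ≡ compatible b (E ∷ʳ y ∷ʳ x)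
  compatible-∷ʳ-comm b E x y
    rewrite compatible-∷ʳ b (E ∷ʳ x) y | compatible-∷ʳ b E x
          | compatible-∷ʳ b (E ∷ʳ y) x | compatible-∷ʳ b E y
    = trans (∧-assoc (compatible b E) _ _)
            (trans (cong (compatible b E ∧_) (∧-comm (not (crosses b x)) _))
                   (sym (∧-assoc (compatible b E) _ _)))

  compatible-¬crosses : ∀ a E → All (λ b → crosses a b ≡ false) E → compatible a E ≡ true
  compatible-¬crosses a []      []             = refl
  compatible-¬crosses a (b ∷ E) (a∤b ∷ a∤E) rewrite a∤b = compatible-¬crosses a E a∤E

  χ : Bool → ℕ
  χ true  = 1
  χ false = 0

  χ-∧ : ∀ b c → χ (b ∧ c) ≡ χ b * χ c
  χ-∧ true  c = sym (+-identityʳ (χ c))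
  χ-∧ false c = refl

  shift : ℕ → Arc → Arc
  shift c (x , y) = (c + x , c + y)

  <ᵇ-shift : ∀ c x y → (c + x <ᵇ c + y) ≡ (x <ᵇ y)
  <ᵇ-shift zero    x y = refl
  <ᵇ-shift (suc c) x y = <ᵇ-shift c x y

  crosses-shift : ∀ c a b → crosses (shift c a) (shift c b) ≡ crosses a b
  crosses-shift c (x , y) (x′ , y′)
    rewrite <ᵇ-shift c x x′ | <ᵇ-shift c x′ y | <ᵇ-shift c y y′
          | <ᵇ-shift c x′ x | <ᵇ-shift c x y′ | <ᵇ-shift c y′ y = refl

  compatible-shift : ∀ c a E → compatible (shift c a) (map (shift c) E) ≡ compatible a E
  compatible-shift c a []      = refl
  compatible-shift c a (b ∷ E) = cong₂ (λ u v → not u ∧ v) (crosses-shift c a b) (compatible-shift c a E)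

  -- count E L = Σ q^|S| over the sets S ⊆ L of pairwise noncrossing arcs crossing no arc of E,
  -- i.e. the number of labellings of L by the unit or one of q other labels whose solid arcs
  -- are pairwise noncrossing and cross no arc of E.
  module WeightedCount (q : ℕ) where

    count : List Arc → List Arc → ℕ
    count E []      = 1
    count E (a ∷ L) = count E L + q * χ (compatible a E) * count (E ∷ʳ a) L

    count-resp-compatible : ∀ E E′ L → All (λ b → compatible b E ≡ compatible b E′) L →
                            count E L ≡ count E′ L
    count-resp-compatible E E′ []      []         = refl
    count-resp-compatible E E′ (a ∷ L) (eq ∷ eqs) =
      cong₂ _+_ (count-resp-compatible E E′ L eqs)
                (cong₂ (λ c n → q * χ c * n) eq
                       (count-resp-compatible (E ∷ʳ a) (E′ ∷ʳ a) L (All.map extend eqs)))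
      where
      extend : ∀ {b} → compatible b E ≡ compatible b E′ → compatible b (E ∷ʳ a) ≡ compatible b (E′ ∷ʳ a)
      extend {b} eq′ = trans (compatible-∷ʳ b E a)
                             (trans (cong (_∧ not (crosses b a)) eq′) (sym (compatible-∷ʳ b E′ a)))

    count-∷ʳ-comm : ∀ E x y L → count (E ∷ʳ x ∷ʳ y) L ≡ count (E ∷ʳ y ∷ʳ x) L
    count-∷ʳ-comm E x y L =
      count-resp-compatible _ _ L (All.tabulate (λ {b} _ → compatible-∷ʳ-comm b E x y))

    count-∷-∷ : ∀ E x y L → count E (x ∷ y ∷ L) ≡
      count E L + q * χ (compatible x E) * count (E ∷ʳ x) L + q * χ (compatible y E) * count (E ∷ʳ y) L
        + q * q * (χ (compatible x E) * χ (compatible y E) * χ (not (crosses x y))) * count (E ∷ʳ x ∷ʳ y) L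
    count-∷-∷ E x y L
      rewrite compatible-∷ʳ y E x | χ-∧ (compatible y E) (not (crosses y x)) | crosses-sym y x
      = expand q (count E L) (χ (compatible x E)) (χ (compatible y E)) (χ (not (crosses x y)))
               (count (E ∷ʳ x) L) (count (E ∷ʳ y) L) (count (E ∷ʳ x ∷ʳ y) L)
      where
      expand : ∀ q c X Y Z cx cy cxy →
        c + q * Y * cy + q * X * (cx + q * (Y * Z) * cxy) ≡ c + q * X * cx + q * Y * cy + q * q * (X * Y * Z) * cxy
      expand = solve-∀

    count-swap : ∀ E x y L → count E (x ∷ y ∷ L) ≡ count E (y ∷ x ∷ L)
    count-swap E x y L
      rewrite count-∷-∷ E x y L | count-∷-∷ E y x L | crosses-sym y x | count-∷ʳ-comm E x y L
      = exchange q (count E L) (χ (compatible x E)) (χ (compatible y E)) (χ (not (crosses x y)))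
                 (count (E ∷ʳ x) L) (count (E ∷ʳ y) L) (count (E ∷ʳ y ∷ʳ x) L)
      where
      exchange : ∀ q c X Y Z cx cy cxy →
        c + q * X * cx + q * Y * cy + q * q * (X * Y * Z) * cxy ≡ c + q * Y * cy + q * X * cx + q * q * (Y * X * Z) * cxy
      exchange = solve-∀

    count-∷-cong : ∀ {L L′} a → (∀ E → count E L ≡ count E L′) → ∀ E → count E (a ∷ L) ≡ count E (a ∷ L′)
    count-∷-cong a eq E = cong₂ (λ m n → m + q * χ (compatible a E) * n) (eq E) (eq (E ∷ʳ a))

    count-↭ : ∀ E {L L′} → L ↭ L′ → count E L ≡ count E L′
    count-↭ E Perm.refl                 = refl
    count-↭ E (prep {xs} {ys} a L↭L′)   = count-∷-cong {xs} {ys} a (λ E′ → count-↭ E′ L↭L′) E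
    count-↭ E (swap {xs} {ys} x y L↭L′) =
      trans (count-swap E x y xs)
            (count-∷-cong {x ∷ xs} {x ∷ ys} y (count-∷-cong {xs} {ys} x (λ E′ → count-↭ E′ L↭L′)) E)
    count-↭ E (Perm.trans L↭L′ L′↭L″) = trans (count-↭ E L↭L′) (count-↭ E L′↭L″)

    count-++-incompatible : ∀ E L₁ L₂ → All (λ b → compatible b E ≡ false) L₂ →
                            count E (L₁ ++ L₂) ≡ count E L₁
    count-++-incompatible E []       []         _          = refl
    count-++-incompatible E []       (b ∷ L₂)   (inc ∷ incs)
      rewrite inc | *-zeroʳ q = trans (+-identityʳ _) (count-++-incompatible E [] L₂ incs)
    count-++-incompatible E (a ∷ L₁) L₂ incs =
      cong₂ (λ m n → m + q * χ (compatible a E) * n)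
            (count-++-incompatible E L₁ L₂ incs)
            (count-++-incompatible (E ∷ʳ a) L₁ L₂ (All.map extend incs))
      where
      extend : ∀ {b} → compatible b E ≡ false → compatible b (E ∷ʳ a) ≡ false
      extend {b} inc = trans (compatible-∷ʳ b E a) (cong (_∧ not (crosses b a)) inc)

    count-∷ʳ-¬crosses : ∀ E a L → All (λ b → crosses b a ≡ false) L → count (E ∷ʳ a) L ≡ count E L
    count-∷ʳ-¬crosses E a L ¬cr =
      count-resp-compatible _ _ L (All.map (λ {b} → compatible-∷ʳ-¬crosses b E a) ¬cr)

    count-++-noncrossing : ∀ E L₁ L₂ → All (λ a → All (λ b → crosses b a ≡ false) L₂) L₁ →
                           count E (L₁ ++ L₂) ≡ count E L₁ * count E L₂
    count-++-noncrossing E []       L₂ _           = sym (+-identityʳ (count E L₂))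
    count-++-noncrossing E (a ∷ L₁) L₂ (¬cr ∷ ¬crs)
      rewrite count-++-noncrossing E L₁ L₂ ¬crs | count-++-noncrossing (E ∷ʳ a) L₁ L₂ ¬crs
            | count-∷ʳ-¬crosses E a L₂ ¬cr
      = distrib q (count E L₁) (count E L₂) (χ (compatible a E)) (count (E ∷ʳ a) L₁)
      where
      distrib : ∀ q m n c k → m * n + q * c * (k * n) ≡ (m + q * c * k) * n
      distrib = solve-∀

    count-∷-free : ∀ E a L → compatible a E ≡ true → All (λ b → crosses b a ≡ false) L →
                   count E (a ∷ L) ≡ suc q * count E L
    count-∷-free E a L compat ¬cr rewrite compat | count-∷ʳ-¬crosses E a L ¬cr | *-identityʳ q = refl

    count-shift : ∀ c E L → count (map (shift c) E) (map (shift c) L) ≡ count E L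
    count-shift c E []      = refl
    count-shift c E (a ∷ L) =
      cong₂ _+_ (count-shift c E L)
                (cong₂ (λ u v → q * χ u * v) (compatible-shift c a E)
                       (trans (cong (λ E′ → count E′ (map (shift c) L)) (sym (map-++ (shift c) E [ a ])))
                              (count-shift c (E ∷ʳ a) L)))

  interval : ℕ → ℕ → List ℕ
  interval a zero    = []
  interval a (suc k) = a ∷ interval (suc a) k

  -- the arcs of the polygon with the k vertices a, a + 1, …, a + k − 1
  polygonArcs : ℕ → ℕ → List Arc
  polygonArcs a zero    = []
  polygonArcs a (suc k) = map (a ,_) (interval (suc a) k) ++ polygonArcs (suc a) k

  interval-++ : ∀ a i j → interval a (i + j) ≡ interval a i ++ interval (a + i) j
  interval-++ a zero    j = cong (λ b → interval b j) (sym (+-identityʳ a))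
  interval-++ a (suc i) j =
    cong (a ∷_) (trans (interval-++ (suc a) i j) (cong (λ b → interval (suc a) i ++ interval b j) (sym (+-suc a i))))

  interval-suc : ∀ a k → interval a (suc k) ≡ interval a k ∷ʳ (a + k)
  interval-suc a k = trans (cong (interval a) (+-comm 1 k)) (interval-++ a k 1)

  map-+-interval : ∀ c a k → map (c +_) (interval a k) ≡ interval (c + a) k
  map-+-interval c a zero    = refl
  map-+-interval c a (suc k) =
    cong (c + a ∷_) (trans (map-+-interval c (suc a) k) (cong (λ b → interval b k) (+-suc c a)))

  map-shift-polygonArcs : ∀ c a k → map (shift c) (polygonArcs a k) ≡ polygonArcs (c + a) k
  map-shift-polygonArcs c a zero    = refl
  map-shift-polygonArcs c a (suc k) = begin
    map (shift c) (map (a ,_) (interval (suc a) k) ++ polygonArcs (suc a) k)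
      ≡⟨ map-++ (shift c) (map (a ,_) (interval (suc a) k)) _ ⟩
    map (shift c) (map (a ,_) (interval (suc a) k)) ++ map (shift c) (polygonArcs (suc a) k)
      ≡⟨ cong₂ _++_ (trans (sym (map-∘ (interval (suc a) k))) (map-∘ (interval (suc a) k)))
                    (map-shift-polygonArcs c (suc a) k) ⟩
    map ((c + a) ,_) (map (c +_) (interval (suc a) k)) ++ polygonArcs (c + suc a) k
      ≡⟨ cong₂ (λ I b → map ((c + a) ,_) I ++ polygonArcs b k)
               (trans (map-+-interval c (suc a) k) (cong (λ b → interval b k) (+-suc c a))) (+-suc c a) ⟩
    polygonArcs (c + a) (suc k) ∎
    where open ≡-Reasoning

  Within : ℕ → ℕ → ℕ → Set
  Within a k z = a ≤ z × z < a + k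

  InPolygon : ℕ → ℕ → Arc → Set
  InPolygon a k (x , z) = a ≤ x × x < z × z < a + k

  interval-within : ∀ a k → All (Within a k) (interval a k)
  interval-within a zero    = []
  interval-within a (suc k) =
    (≤-refl , subst (a <_) (sym (+-suc a k)) (m≤m+n (suc a) k))
    ∷ All.map (λ {z} (a<z , z<) → <⇒≤ a<z , subst (z <_) (sym (+-suc a k)) z<) (interval-within (suc a) k)

  polygonArcs-inPolygon : ∀ a k → All (InPolygon a k) (polygonArcs a k)
  polygonArcs-inPolygon a zero    = []
  polygonArcs-inPolygon a (suc k) = ++⁺
    (map⁺ (All.map (λ {z} (a<z , z<) → ≤-refl , a<z , subst (z <_) (sym (+-suc a k)) z<)
                   (interval-within (suc a) k)))
    (All.map (λ {(x , z)} (a<x , x<z , z<) → <⇒≤ a<x , x<z , subst (z <_) (sym (+-suc a k)) z<)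
             (polygonArcs-inPolygon (suc a) k))

  Straddles : ℕ → ℕ → Arc → Set
  Straddles a v (x , z) = a ≤ x × x < v × v < z

  polygonArcs-split : ∀ a i l → Σ[ C ∈ List Arc ]
    (polygonArcs a (i + suc l) ↭ polygonArcs a (suc i) ++ polygonArcs (a + i) (suc l) ++ C)
    × All (Straddles a (a + i)) C
  polygonArcs-split a zero    l =
    [] , ↭-reflexive (sym (trans (++-identityʳ _) (cong (λ b → polygonArcs b (suc l)) (+-identityʳ a)))) , []
  polygonArcs-split a (suc i) l with polygonArcs-split (suc a) i l
  ... | C , split , straddles = F₂ ++ C , perm , ++⁺ F₂-straddles (All.map widen straddles)
    where
    F₁ F₂ I O : List Arc
    F₁ = map (a ,_) (interval (suc a) (suc i))
    F₂ = map (a ,_) (interval (suc a + suc i) l)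
    I  = polygonArcs (suc a) (suc i)
    O  = polygonArcs (a + suc i) (suc l)

    perm : polygonArcs a (suc i + suc l) ↭ (F₁ ++ I) ++ O ++ F₂ ++ C
    perm = begin
      polygonArcs a (suc i + suc l)
        ≡⟨ cong (λ I′ → map (a ,_) I′ ++ polygonArcs (suc a) (i + suc l))
                (trans (cong (interval (suc a)) (+-suc i l)) (interval-++ (suc a) (suc i) l)) ⟩
      map (a ,_) (interval (suc a) (suc i) ++ interval (suc a + suc i) l) ++ polygonArcs (suc a) (i + suc l)
        ≡⟨ cong (_++ polygonArcs (suc a) (i + suc l)) (map-++ (a ,_) (interval (suc a) (suc i)) _) ⟩
      (F₁ ++ F₂) ++ polygonArcs (suc a) (i + suc l)
        ↭⟨ Perm.++⁺ˡ (F₁ ++ F₂) split ⟩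
      (F₁ ++ F₂) ++ I ++ polygonArcs (suc a + i) (suc l) ++ C
        ≡⟨ cong (λ b → (F₁ ++ F₂) ++ I ++ polygonArcs b (suc l) ++ C) (sym (+-suc a i)) ⟩
      (F₁ ++ F₂) ++ I ++ O ++ C
        ≡⟨ trans (++-assoc F₁ F₂ _) (cong (λ X → F₁ ++ F₂ ++ X) (sym (++-assoc I O C))) ⟩
      F₁ ++ F₂ ++ (I ++ O) ++ C
        ↭⟨ Perm.++⁺ˡ F₁ (Perm.shifts F₂ (I ++ O)) ⟩
      F₁ ++ (I ++ O) ++ F₂ ++ C
        ≡⟨ trans (cong (F₁ ++_) (++-assoc I O (F₂ ++ C))) (sym (++-assoc F₁ I _)) ⟩
      (F₁ ++ I) ++ O ++ F₂ ++ C ∎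
      where open Perm.PermutationReasoning

    F₂-straddles : All (Straddles a (a + suc i)) F₂
    F₂-straddles = map⁺ (All.map (λ (<z , _) → ≤-refl , m<m+n a z<s , <z) (interval-within (suc a + suc i) l))

    widen : ∀ {b} → Straddles (suc a) (suc a + i) b → Straddles a (a + suc i) b
    widen {x , z} (a<x , x< , <z) =
      <⇒≤ a<x , subst (x <_) (sym (+-suc a i)) x< , subst (_< z) (sym (+-suc a i)) <z

  fan : ℕ → List Arc
  fan zero    = []
  fan (suc k) = (0 , suc k) ∷ fan k

  fan-↭ : ∀ k → map (0 ,_) (interval 1 k) ↭ fan k
  fan-↭ zero    = ↭-refl
  fan-↭ (suc k) = begin
    map (0 ,_) (interval 1 (suc k))        ≡⟨ cong (map (0 ,_)) (interval-suc 1 k) ⟩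
    map (0 ,_) (interval 1 k ∷ʳ suc k)     ≡⟨ map-++ (0 ,_) (interval 1 k) [ suc k ] ⟩
    map (0 ,_) (interval 1 k) ∷ʳ (0 , suc k) ↭⟨ Perm.++-comm (map (0 ,_) (interval 1 k)) [ 0 , suc k ] ⟩
    (0 , suc k) ∷ map (0 ,_) (interval 1 k) <⟨ fan-↭ k ⟩
    fan (suc k)                            ∎
    where open Perm.PermutationReasoning

  Below : ℕ → Arc → Set
  Below k (x , z) = x < z × z ≤ k

  fan-below : ∀ k → All (Below k) (fan k)
  fan-below zero    = []
  fan-below (suc k) = (z<s , ≤-refl) ∷ All.map (λ (x<z , z≤k) → x<z , m≤n⇒m≤1+n z≤k) (fan-below k)

  module PolygonCount (q : ℕ) where
    open WeightedCount q

    polygonCount : ℕ → ℕ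
    polygonCount k = count [] (polygonArcs 0 k)

    count-polygonArcs : ∀ a k → count [] (polygonArcs a k) ≡ polygonCount k
    count-polygonArcs a k = begin
      count [] (polygonArcs a k)
        ≡⟨ cong (λ b → count [] (polygonArcs b k)) (sym (+-identityʳ a)) ⟩
      count [] (polygonArcs (a + 0) k)
        ≡⟨ cong (count []) (sym (map-shift-polygonArcs a 0 k)) ⟩
      count [] (map (shift a) (polygonArcs 0 k))
        ≡⟨ count-shift a [] (polygonArcs 0 k) ⟩
      polygonCount k ∎
      where open ≡-Reasoning

    polygonCount-two : polygonCount 2 ≡ suc q
    polygonCount-two = cong suc (trans (*-identityʳ (q * 1)) (*-identityʳ q))

    -- the polygon 0, 1, …, j + 1 without its base (0 , j + 1)
    baseless : ℕ → ℕ
    baseless j = count [] (fan j ++ polygonArcs 1 (suc j))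

    -- the polygon 0, 1, …, i + l + 1 in which the only arcs from 0 are those of fan i
    partialFan : ℕ → ℕ → ℕ
    partialFan i l = count [] (fan i ++ polygonArcs 1 (i + suc l))

    polygonCount-base : ∀ j → polygonCount (2 + j) ≡ suc q * baseless j
    polygonCount-base j = trans
      (count-↭ [] (Perm.++⁺ʳ (polygonArcs 1 (suc j)) (fan-↭ (suc j))))
      (count-∷-free [] (0 , suc j) _ refl
         (++⁺ (All.map (λ {(x , _)} (_ , z≤j) → nested⇒¬crosses {x} z≤n (m≤n⇒m≤1+n z≤j)) (fan-below j))
              (All.map (λ {(x , _)} (_ , _ , z<) → nested⇒¬crosses {x} z≤n (≤-pred z<))
                      (polygonArcs-inPolygon 1 (suc j)))))

    baseless-partialFan : ∀ j → baseless j ≡ partialFan j 0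
    baseless-partialFan j = cong (λ k → count [] (fan j ++ polygonArcs 1 k)) (sym (+-comm j 1))

    partialFan-zero : ∀ l → partialFan 0 l ≡ polygonCount (suc l)
    partialFan-zero l = count-polygonArcs 1 (suc l)

    -- once (0 , i + 1) is solid, the arcs crossing it drop out and the polygon splits along it
    count-split-along : ∀ i l → count [ (0 , suc i) ] (fan i ++ polygonArcs 1 (i + suc (suc l))) ≡
                                baseless i * polygonCount (2 + l)
    count-split-along i l with polygonArcs-split 1 i (suc l)
    ... | C , split , straddles = begin
      count [ e ] (fan i ++ polygonArcs 1 (i + suc (suc l)))
        ≡⟨ count-↭ [ e ] (Perm.++⁺ˡ (fan i) split) ⟩
      count [ e ] (fan i ++ In ++ Out ++ C)
        ≡⟨ cong (count [ e ]) (sym (trans (++-assoc (fan i ++ In) Out C) (++-assoc (fan i) In (Out ++ C)))) ⟩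
      count [ e ] (((fan i ++ In) ++ Out) ++ C)
        ≡⟨ count-++-incompatible [ e ] ((fan i ++ In) ++ Out) C (All.map crosses-e straddles) ⟩
      count [ e ] ((fan i ++ In) ++ Out)
        ≡⟨ count-++-noncrossing [ e ] (fan i ++ In) Out
             (All.map (λ a-below → All.map (right-¬crosses a-below) Out-inPolygon) below) ⟩
      count [ e ] (fan i ++ In) * count [ e ] Out
        ≡⟨ cong₂ _*_ (count-∷ʳ-¬crosses [] e (fan i ++ In) (All.map below-¬crosses-e below))
                     (trans (count-∷ʳ-¬crosses [] e Out (All.map (right-¬crosses (z<s , ≤-refl)) Out-inPolygon))
                            (count-polygonArcs (suc i) (suc (suc l)))) ⟩
      baseless i * polygonCount (2 + l) ∎
      where
      open ≡-Reasoning
      e : Arc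
      e = (0 , suc i)
      In Out : List Arc
      In  = polygonArcs 1 (suc i)
      Out = polygonArcs (suc i) (suc (suc l))

      below : All (Below (suc i)) (fan i ++ In)
      below = ++⁺ (All.map (λ (x<z , z≤i) → x<z , m≤n⇒m≤1+n z≤i) (fan-below i))
                  (All.map (λ (_ , x<z , z<) → x<z , ≤-pred z<) (polygonArcs-inPolygon 1 (suc i)))

      Out-inPolygon : All (InPolygon (suc i) (suc (suc l))) Out
      Out-inPolygon = polygonArcs-inPolygon (suc i) (suc (suc l))

      right-¬crosses : ∀ {a b} → Below (suc i) a → InPolygon (suc i) (suc (suc l)) b → crosses b a ≡ false
      right-¬crosses {a} {b} (x<z , z≤i) (i≤x′ , _) = trans (crosses-sym b a) (disjoint⇒¬crosses x<z (≤-trans z≤i i≤x′))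

      below-¬crosses-e : ∀ {a} → Below (suc i) a → crosses a e ≡ false
      below-¬crosses-e {x , _} (_ , z≤i) = nested⇒¬crosses {x} z≤n z≤i

      crosses-e : ∀ {b} → Straddles 1 (1 + i) b → compatible b [ e ] ≡ false
      crosses-e (0<x , x<i , i<z) = cong (λ c → not c ∧ true) (interleaved⇒crosses 0<x x<i i<z)

    partialFan-suc : ∀ i l → partialFan (suc i) l ≡ partialFan i (suc l) + q * (baseless i * polygonCount (2 + l))
    partialFan-suc i l =
      cong₂ _+_ (cong (λ k → count [] (fan i ++ polygonArcs 1 k)) reindex)
                (trans (cong (λ k → q * 1 * count [ (0 , suc i) ] (fan i ++ polygonArcs 1 k)) reindex)
                       (cong₂ _*_ (*-identityʳ q) (count-split-along i l)))
      where
      reindex : suc i + suc l ≡ i + suc (suc l)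
      reindex = sym (+-suc i (suc l))

module Coefficients where
  open import Data.Nat as ℕ using (ℕ; zero; suc; _∸_; _<_; z<s; s<s)
  open import Data.Integer using (ℤ; +_; _+_; _-_; _*_; -_)
  open import Data.Integer.Properties
    using (+-identityʳ; +-identityˡ; +-assoc; *-zeroʳ; *-zeroˡ; *-identityʳ; *-identityˡ; *-assoc; *-distribˡ-+; *-distribʳ-+)
  open import Data.Integer.Tactic.RingSolver using (solve-∀)
  open import Data.List using (foldr; applyUpTo)
  open import Data.List.Properties using (map-upTo)

  sumBelow : (ℕ → ℤ) → ℕ → ℤ
  sumBelow f k = foldr _+_ (+ 0) (applyUpTo f k)

  sumBelow-suc : ∀ f k → sumBelow f (suc k) ≡ sumBelow f k + f k
  sumBelow-suc f zero    = trans (+-identityʳ (f 0)) (sym (+-identityˡ (f 0)))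
  sumBelow-suc f (suc k) = trans (cong (_+_ (f 0)) (sumBelow-suc (f ∘ suc) k)) (sym (+-assoc (f 0) _ _))

  sumBelow-cong : ∀ {f g} k → (∀ i → i < k → f i ≡ g i) → sumBelow f k ≡ sumBelow g k
  sumBelow-cong zero    eq = refl
  sumBelow-cong (suc k) eq = cong₂ _+_ (eq 0 z<s) (sumBelow-cong k (λ i i<k → eq (suc i) (s<s i<k)))

  sumBelow-zero : ∀ {f} k → (∀ i → f i ≡ + 0) → sumBelow f k ≡ + 0
  sumBelow-zero zero    _  = refl
  sumBelow-zero (suc k) eq = cong₂ _+_ (eq 0) (sumBelow-zero k (eq ∘ suc))

  sumBelow-+ : ∀ f g k → sumBelow (λ i → f i + g i) k ≡ sumBelow f k + sumBelow g k
  sumBelow-+ f g zero    = refl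
  sumBelow-+ f g (suc k) rewrite sumBelow-+ (f ∘ suc) (g ∘ suc) k = exchange (f 0) (g 0) (sumBelow (f ∘ suc) k) (sumBelow (g ∘ suc) k)
    where
    exchange : ∀ a b c d → a + b + (c + d) ≡ a + c + (b + d)
    exchange = solve-∀

  *-sumBelow : ∀ c f k → c * sumBelow f k ≡ sumBelow (λ i → c * f i) k
  *-sumBelow c f zero    = *-zeroʳ c
  *-sumBelow c f (suc k) = trans (*-distribˡ-+ c (f 0) _) (cong (_+_ (c * f 0)) (*-sumBelow c (f ∘ suc) k))

  ⊛-sumBelow : ∀ f g n → (f ⊛ g) n ≡ sumBelow (λ i → f i * g (n ∸ i)) (suc n)
  ⊛-sumBelow f g n = cong (foldr _+_ (+ 0)) (map-upTo (λ i → f i * g (n ∸ i)) (suc n))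

  ⊛-zero : ∀ f g → (f ⊛ g) 0 ≡ f 0 * g 0
  ⊛-zero f g = +-identityʳ (f 0 * g 0)

  ⊛-suc : ∀ f g n → (f ⊛ g) (suc n) ≡ f 0 * g (suc n) + ((f ∘ suc) ⊛ g) n
  ⊛-suc f g n = trans (⊛-sumBelow f g (suc n)) (cong (_+_ (f 0 * g (suc n))) (sym (⊛-sumBelow (f ∘ suc) g n)))

  ⊛-congˡ : ∀ {f f′} g n → (∀ i → f i ≡ f′ i) → (f ⊛ g) n ≡ (f′ ⊛ g) n
  ⊛-congˡ {f} {f′} g n eq = trans (⊛-sumBelow f g n)
    (trans (sumBelow-cong (suc n) (λ i _ → cong (_* g (n ∸ i)) (eq i))) (sym (⊛-sumBelow f′ g n)))

  ⊕-⊛ : ∀ f g h n → ((f ⊕ g) ⊛ h) n ≡ (f ⊛ h) n + (g ⊛ h) n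
  ⊕-⊛ f g h n = begin
    ((f ⊕ g) ⊛ h) n
      ≡⟨ ⊛-sumBelow (f ⊕ g) h n ⟩
    sumBelow (λ i → (f i + g i) * h (n ∸ i)) (suc n)
      ≡⟨ sumBelow-cong (suc n) (λ i _ → *-distribʳ-+ (h (n ∸ i)) (f i) (g i)) ⟩
    sumBelow (λ i → f i * h (n ∸ i) + g i * h (n ∸ i)) (suc n)
      ≡⟨ sumBelow-+ (λ i → f i * h (n ∸ i)) (λ i → g i * h (n ∸ i)) (suc n) ⟩
    sumBelow (λ i → f i * h (n ∸ i)) (suc n) + sumBelow (λ i → g i * h (n ∸ i)) (suc n)
      ≡⟨ sym (cong₂ _+_ (⊛-sumBelow f h n) (⊛-sumBelow g h n)) ⟩
    (f ⊛ h) n + (g ⊛ h) n ∎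
    where open ≡-Reasoning

  const-⊛ : ∀ c f n → (const c ⊛ f) n ≡ c * f n
  const-⊛ c f zero    = +-identityʳ (c * f 0)
  const-⊛ c f (suc n) = begin
    (const c ⊛ f) (suc n)                         ≡⟨ ⊛-suc (const c) f n ⟩
    c * f (suc n) + ((const c ∘ suc) ⊛ f) n       ≡⟨ cong (_+_ (c * f (suc n))) (⊛-sumBelow (const c ∘ suc) f n) ⟩
    c * f (suc n) + sumBelow (λ i → + 0 * f (n ∸ i)) (suc n)
      ≡⟨ cong (_+_ (c * f (suc n))) (sumBelow-zero (suc n) (λ i → *-zeroˡ (f (n ∸ i)))) ⟩
    c * f (suc n) + + 0                           ≡⟨ +-identityʳ _ ⟩
    c * f (suc n)                                 ∎
    where open ≡-Reasoning

  const-⊛-⊛ : ∀ c f g n → ((const c ⊛ f) ⊛ g) n ≡ c * (f ⊛ g) n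
  const-⊛-⊛ c f g n = begin
    ((const c ⊛ f) ⊛ g) n                          ≡⟨ ⊛-congˡ g n (const-⊛ c f) ⟩
    ((λ i → c * f i) ⊛ g) n                        ≡⟨ ⊛-sumBelow (λ i → c * f i) g n ⟩
    sumBelow (λ i → c * f i * g (n ∸ i)) (suc n)   ≡⟨ sumBelow-cong (suc n) (λ i _ → *-assoc c (f i) (g (n ∸ i))) ⟩
    sumBelow (λ i → c * (f i * g (n ∸ i))) (suc n) ≡⟨ sym (*-sumBelow c (λ i → f i * g (n ∸ i)) (suc n)) ⟩
    c * sumBelow (λ i → f i * g (n ∸ i)) (suc n)   ≡⟨ cong (c *_) (sym (⊛-sumBelow f g n)) ⟩
    c * (f ⊛ g) n                                  ∎
    where open ≡-Reasoning

  t-⊛-zero : ∀ f → (t ⊛ f) 0 ≡ + 0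
  t-⊛-zero f = trans (⊛-zero t f) (*-zeroˡ (f 0))

  t-⊛-suc : ∀ f n → (t ⊛ f) (suc n) ≡ f n
  t-⊛-suc f n = begin
    (t ⊛ f) (suc n)                          ≡⟨ ⊛-suc t f n ⟩
    + 0 * f (suc n) + ((t ∘ suc) ⊛ f) n      ≡⟨ cong₂ _+_ (*-zeroˡ (f (suc n))) (⊛-congˡ f n t∘suc≗1) ⟩
    + 0 + (const (+ 1) ⊛ f) n                ≡⟨ +-identityˡ _ ⟩
    (const (+ 1) ⊛ f) n                      ≡⟨ const-⊛ (+ 1) f n ⟩
    + 1 * f n                                ≡⟨ *-identityˡ (f n) ⟩
    f n                                      ∎
    where
    open ≡-Reasoning
    t∘suc≗1 : ∀ i → t (suc i) ≡ const (+ 1) i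
    t∘suc≗1 zero    = refl
    t∘suc≗1 (suc i) = refl

  α β : ℤ → ℤ
  α m = m * m * m - + 2 * m * m + + 2 * m - + 1
  β m = + 2 * m * m - + 3 * m + + 2

  functionalEquation : ℤ → PowerSeries → PowerSeries
  functionalEquation m H = t ⊕ const (α m) ⊛ t ⊛ t ⊕ (const (β m) ⊛ t ⊕ const (- + 1)) ⊛ H ⊕ const (m - + 1) ⊛ H ⊛ H

  functionalEquation-coefficient : ∀ m H n → functionalEquation m H n ≡
    t n + α m * (t ⊛ t) n + (β m * (t ⊛ H) n + - + 1 * H n) + (m - + 1) * (H ⊛ H) n
  functionalEquation-coefficient m H n =
    cong₂ _+_ (cong₂ _+_ (cong (_+_ (t n)) (const-⊛-⊛ (α m) t t n))
                         (trans (⊕-⊛ (const (β m) ⊛ t) (const (- + 1)) H n)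
                                (cong₂ _+_ (const-⊛-⊛ (β m) t H n) (const-⊛ (- + 1) H n))))
              (const-⊛-⊛ (m - + 1) H H n)

  functionalEquation-vanishes : ∀ m H → H 0 ≡ + 0 → H 1 ≡ + 1 → H 2 ≡ m * m * m →
    (∀ p → H (suc (suc (suc p))) ≡ β m * H (suc (suc p)) + (m - + 1) * (H ⊛ H) (suc (suc (suc p)))) →
    ∀ n → functionalEquation m H n ≡ + 0
  functionalEquation-vanishes m H H₀ H₁ H₂ Hrec n rewrite functionalEquation-coefficient m H n = vanishes n
    where
    HH₁ : (H ⊛ H) 1 ≡ + 0
    HH₁ = trans (⊛-sumBelow H H 1) (cong₂ (λ h₀ h₁ → h₀ * h₁ + (h₁ * h₀ + + 0)) H₀ H₁)

    HH₂ : (H ⊛ H) 2 ≡ + 1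
    HH₂ = trans (⊛-sumBelow H H 2)
                (trans (cong₂ (λ h₀ h₁ → h₀ * H 2 + (h₁ * h₁ + (H 2 * h₀ + + 0))) H₀ H₁) (evaluate (H 2)))
      where
      evaluate : ∀ h₂ → + 0 * h₂ + (+ 1 * + 1 + (h₂ * + 0 + + 0)) ≡ + 1
      evaluate = solve-∀

    vanishes : ∀ n → t n + α m * (t ⊛ t) n + (β m * (t ⊛ H) n + - + 1 * H n) + (m - + 1) * (H ⊛ H) n ≡ + 0
    vanishes zero
      rewrite t-⊛-zero t | t-⊛-zero H | ⊛-zero H H | H₀ = zeroes (α m) (β m) (m - + 1)
      where
      zeroes : ∀ a b c → + 0 + a * + 0 + (b * + 0 + - + 1 * + 0) + c * (+ 0 * + 0) ≡ + 0
      zeroes = solve-∀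
    vanishes (suc zero)
      rewrite t-⊛-suc t 0 | t-⊛-suc H 0 | HH₁ | H₀ | H₁ = linear (α m) (β m) (m - + 1)
      where
      linear : ∀ a b c → + 1 + a * + 0 + (b * + 0 + - + 1 * + 1) + c * + 0 ≡ + 0
      linear = solve-∀
    vanishes (suc (suc zero))
      rewrite t-⊛-suc t 1 | t-⊛-suc H 1 | HH₂ | H₁ | H₂ = quadratic m
      where
      quadratic : ∀ m → + 0 + (m * m * m - + 2 * m * m + + 2 * m - + 1) * + 1
                        + ((+ 2 * m * m - + 3 * m + + 2) * + 1 + - + 1 * (m * m * m)) + (m - + 1) * + 1 ≡ + 0
      quadratic = solve-∀
    vanishes (suc (suc (suc p))) = begin
      + 0 + α m * (t ⊛ t) n₃ + (β m * (t ⊛ H) n₃ + - + 1 * H n₃) + (m - + 1) * (H ⊛ H) n₃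
        ≡⟨ cong₂ (λ a b → + 0 + α m * a + (β m * b + - + 1 * H n₃) + (m - + 1) * (H ⊛ H) n₃)
                 (t-⊛-suc t (suc (suc p))) (t-⊛-suc H (suc (suc p))) ⟩
      + 0 + α m * + 0 + (β m * H n₂ + - + 1 * H n₃) + (m - + 1) * (H ⊛ H) n₃
        ≡⟨ cong (λ h → + 0 + α m * + 0 + (β m * H n₂ + - + 1 * h) + (m - + 1) * (H ⊛ H) n₃) (Hrec p) ⟩
      + 0 + α m * + 0 + (β m * H n₂ + - + 1 * (β m * H n₂ + (m - + 1) * (H ⊛ H) n₃)) + (m - + 1) * (H ⊛ H) n₃
        ≡⟨ higher (α m) (β m) (m - + 1) (H n₂) ((H ⊛ H) n₃) ⟩
      + 0 ∎
      where
      open ≡-Reasoning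
      n₂ n₃ : ℕ
      n₂ = suc (suc p)
      n₃ = suc n₂
      higher : ∀ a b c h hh → + 0 + a * + 0 + (b * h + - + 1 * (b * h + c * hh)) + c * hh ≡ + 0
      higher = solve-∀

module PolygonRecurrence (q : ℕ) where
  open import Data.Nat as ℕ using (ℕ; zero; suc; _∸_)
  import Data.Nat.Properties as ℕ
  open import Data.Integer using (ℤ; +_; _+_; _*_)
  open import Data.Integer.Properties using (pos-+; pos-*; *-zeroʳ; +-identityʳ; *-assoc)
  open import Data.Integer.Tactic.RingSolver using (solve-∀)
  open Noncrossing.PolygonCount q
  open Coefficients using (sumBelow; sumBelow-suc; sumBelow-cong; *-sumBelow)

  closedForm : ℕ → ℕ → ℤ
  closedForm i k = + polygonCount (suc k) + + q * sumBelow (λ j → + baseless j * + polygonCount (suc (k ∸ j))) i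

  closedForm-suc : ∀ i k → closedForm (suc i) k ≡ closedForm i k + + q * (+ baseless i * + polygonCount (suc (k ∸ i)))
  closedForm-suc i k rewrite sumBelow-suc (λ j → + baseless j * + polygonCount (suc (k ∸ j))) i =
    reassociate (+ polygonCount (suc k)) (+ q) (sumBelow (λ j → + baseless j * + polygonCount (suc (k ∸ j))) i) _
    where
    reassociate : ∀ a q s x → a + q * (s + x) ≡ a + q * s + q * x
    reassociate = solve-∀

  partialFan-closed : ∀ i l → + partialFan i l ≡ closedForm i (i ℕ.+ l)
  partialFan-closed zero    l = trans (cong +_ (partialFan-zero l))
                                      (sym (trans (cong (_+_ (+ polygonCount (suc l))) (*-zeroʳ (+ q))) (+-identityʳ _)))
  partialFan-closed (suc i) l = begin
    + partialFan (suc i) l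
      ≡⟨ cong +_ (partialFan-suc i l) ⟩
    + (partialFan i (suc l) ℕ.+ q ℕ.* (baseless i ℕ.* polygonCount (2 ℕ.+ l)))
      ≡⟨ trans (pos-+ (partialFan i (suc l)) _) (cong (_+_ (+ partialFan i (suc l)))
                 (trans (pos-* q (baseless i ℕ.* polygonCount (2 ℕ.+ l))) (cong (+ q *_) (pos-* (baseless i) _)))) ⟩
    + partialFan i (suc l) + + q * (+ baseless i * + polygonCount (2 ℕ.+ l))
      ≡⟨ cong₂ (λ c k → c + + q * (+ baseless i * + polygonCount (suc k)))
               (partialFan-closed i (suc l)) (sym (ℕ.m+n∸m≡n i (suc l))) ⟩
    closedForm i (i ℕ.+ suc l) + + q * (+ baseless i * + polygonCount (suc (i ℕ.+ suc l ∸ i)))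
      ≡⟨ sym (closedForm-suc i (i ℕ.+ suc l)) ⟩
    closedForm (suc i) (i ℕ.+ suc l)
      ≡⟨ cong (closedForm (suc i)) (ℕ.+-suc i l) ⟩
    closedForm (suc i) (suc i ℕ.+ l) ∎
    where open ≡-Reasoning

  polygonCount-recurrence : ∀ j → + polygonCount (2 ℕ.+ j) ≡
    + suc q * + polygonCount (suc j) + + q * sumBelow (λ i → + polygonCount (2 ℕ.+ i) * + polygonCount (suc (j ∸ i))) j
  polygonCount-recurrence j = begin
    + polygonCount (2 ℕ.+ j)
      ≡⟨ cong +_ (polygonCount-base j) ⟩
    + (suc q ℕ.* baseless j)
      ≡⟨ pos-* (suc q) (baseless j) ⟩
    + suc q * + baseless j
      ≡⟨ cong (λ b → + suc q * b) (trans (cong +_ (baseless-partialFan j))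
                                         (trans (partialFan-closed j 0) (cong (closedForm j) (ℕ.+-identityʳ j)))) ⟩
    + suc q * closedForm j j
      ≡⟨ distribute (+ suc q) (+ polygonCount (suc j)) (+ q) S ⟩
    + suc q * + polygonCount (suc j) + + q * (+ suc q * S)
      ≡⟨ cong (λ s → + suc q * + polygonCount (suc j) + + q * s)
              (trans (*-sumBelow (+ suc q) (λ i → + baseless i * + polygonCount (suc (j ∸ i))) j)
                     (sumBelow-cong j (λ i _ → trans (sym (*-assoc (+ suc q) (+ baseless i) _))
                                                     (cong (_* + polygonCount (suc (j ∸ i))) (base i))))) ⟩
    + suc q * + polygonCount (suc j) + + q * sumBelow (λ i → + polygonCount (2 ℕ.+ i) * + polygonCount (suc (j ∸ i))) j ∎
    where
    open ≡-Reasoning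
    S : ℤ
    S = sumBelow (λ i → + baseless i * + polygonCount (suc (j ∸ i))) j
    base : ∀ i → + suc q * + baseless i ≡ + polygonCount (2 ℕ.+ i)
    base i = trans (sym (pos-* (suc q) (baseless i))) (cong +_ (sym (polygonCount-base i)))
    distribute : ∀ m a q s → m * (a + q * s) ≡ m * a + q * (m * s)
    distribute = solve-∀

module Labellings (M : FiniteUnitaryMagma) where
  open import Data.Nat
  open import Data.Nat.Properties
  open import Data.Nat.ListAction using (sum)
  open import Data.Sum using (_⊎_; inj₁; inj₂)
  open import Data.List using (filterᵇ; length; zip; concatMap; tabulate; allFin; applyUpTo)
  open import Data.Bool.ListAction using (and)
  open import Data.List.Properties
    using (map-cong; map-∘; map-upTo; length-++; length-map; length-tabulate; map-tabulate; tabulate-cong; filter-++; filter-≐)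
  open import Data.Vec as Vec using (Vec)
  open import Data.Fin as Fin using (Fin)
  open import Data.Fin.Properties using () renaming (_≟_ to _≟Fin_)
  open import Function.Bundles using (Inverse)
  open import Relation.Nullary.Decidable using (does; T?)
  open Noncrossing
  open FiniteUnitaryMagma M

  all-true : ∀ {A : Set} (xs : List A) → all (λ _ → true) xs ≡ true
  all-true []       = refl
  all-true (_ ∷ xs) = all-true xs

  all-cong : ∀ {A : Set} {f g : A → Bool} xs → (∀ x → f x ≡ g x) → all f xs ≡ all g xs
  all-cong xs eq = cong and (map-cong eq xs)

  all-++ : ∀ {A : Set} (f : A → Bool) xs ys → all f (xs ++ ys) ≡ all f xs ∧ all f ys
  all-++ f []       ys = refl
  all-++ f (x ∷ xs) ys = trans (cong (f x ∧_) (all-++ f xs ys)) (sym (∧-assoc (f x) _ _))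

  all-∧ : ∀ {A : Set} (f g : A → Bool) xs → all (λ x → f x ∧ g x) xs ≡ all f xs ∧ all g xs
  all-∧ f g []       = refl
  all-∧ f g (x ∷ xs) rewrite all-∧ f g xs = interchange (f x) (g x) (all f xs) (all g xs)
    where
    interchange : ∀ a b c d → (a ∧ b) ∧ (c ∧ d) ≡ (a ∧ c) ∧ (b ∧ d)
    interchange true  true  c d = refl
    interchange true  false c d = sym (∧-zeroʳ c)
    interchange false b     c d = refl

  length-filterᵇ-concatMap : ∀ {A B : Set} (p : B → Bool) (f : A → List B) xs →
    length (filterᵇ p (concatMap f xs)) ≡ sum (map (λ x → length (filterᵇ p (f x))) xs)
  length-filterᵇ-concatMap p f []       = refl
  length-filterᵇ-concatMap p f (x ∷ xs) =
    trans (cong length (filter-++ (T? ∘ p) (f x) (concatMap f xs)))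
          (trans (length-++ (filterᵇ p (f x))) (cong (length (filterᵇ p (f x)) +_) (length-filterᵇ-concatMap p f xs)))

  length-filterᵇ-map : ∀ {A B : Set} (p : B → Bool) (f : A → B) xs →
    length (filterᵇ p (map f xs)) ≡ length (filterᵇ (p ∘ f) xs)
  length-filterᵇ-map p f []       = refl
  length-filterᵇ-map p f (x ∷ xs) with p (f x)
  ... | true  = cong suc (length-filterᵇ-map p f xs)
  ... | false = length-filterᵇ-map p f xs

  length-filterᵇ-∧ : ∀ {A : Set} b (p : A → Bool) xs → length (filterᵇ (λ x → b ∧ p x) xs) ≡ χ b * length (filterᵇ p xs)
  length-filterᵇ-∧ true  p xs = sym (+-identityʳ _)
  length-filterᵇ-∧ false p []       = refl
  length-filterᵇ-∧ false p (_ ∷ xs) = length-filterᵇ-∧ false p xs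

  length-filterᵇ-if : ∀ {A : Set} b (p p′ : A → Bool) xs →
    length (filterᵇ (λ x → if b then p x else p′ x) xs) ≡ (if b then length (filterᵇ p xs) else length (filterᵇ p′ xs))
  length-filterᵇ-if true  p p′ xs = refl
  length-filterᵇ-if false p p′ xs = refl

  sum-map-const : ∀ {A : Set} (xs : List A) k → sum (map (λ _ → k) xs) ≡ length xs * k
  sum-map-const []       k = refl
  sum-map-const (_ ∷ xs) k = cong (k +_) (sum-map-const xs k)

  sum-tabulate-const : ∀ k x → sum (tabulate {n = k} (λ _ → x)) ≡ k * x
  sum-tabulate-const zero    x = refl
  sum-tabulate-const (suc k) x = cong (x +_) (sum-tabulate-const k x)

  sum-tabulate-≟ : ∀ k (u : Fin k) x y → sum (tabulate (λ i → if not (does (i ≟Fin u)) then x else y)) ≡ y + (k ∸ 1) * x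
  sum-tabulate-≟ (suc k)       Fin.zero    x y = cong (y +_) (sum-tabulate-const k x)
  sum-tabulate-≟ (suc (suc k)) (Fin.suc u) x y = trans (cong (x +_) (sum-tabulate-≟ (suc k) u x y)) (x+[y+kx] x y k)
    where
    x+[y+kx] : ∀ x y k → x + (y + k * x) ≡ y + (x + k * x)
    x+[y+kx] x y k = trans (sym (+-assoc x y _)) (trans (cong (_+ k * x) (+-comm x y)) (+-assoc y x _))

  T-⊎-of-not∧not≡false : ∀ b c → not b ∧ not c ≡ false → T b ⊎ T c
  T-⊎-of-not∧not≡false true  _    _ = inj₁ _
  T-⊎-of-not∧not≡false false true _ = inj₂ _

  q : ℕ
  q = card ∸ 1

  card≡1+q : card ≡ suc q
  card≡1+q = inhabited (Inverse.to enumeration 𝟙)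
    where
    inhabited : ∀ {k} → Fin k → k ≡ suc (k ∸ 1)
    inhabited {suc k} _ = refl

  open WeightedCount q
  open PolygonCount q

  pairwiseCompatible : List Arc → Bool
  pairwiseCompatible E = all (λ a → compatible a E) E

  pairwiseCompatible-∷ʳ : ∀ E a → pairwiseCompatible (E ∷ʳ a) ≡ pairwiseCompatible E ∧ compatible a E
  pairwiseCompatible-∷ʳ E a = begin
    all (λ b → compatible b (E ∷ʳ a)) (E ∷ʳ a)
      ≡⟨ all-++ (λ b → compatible b (E ∷ʳ a)) E [ a ] ⟩
    all (λ b → compatible b (E ∷ʳ a)) E ∧ (compatible a (E ∷ʳ a) ∧ true)
      ≡⟨ cong₂ _∧_ (all-cong E (λ b → compatible-∷ʳ b E a)) (trans (∧-identityʳ _) (compatible-∷ʳ a E a)) ⟩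
    all (λ b → compatible b E ∧ not (crosses b a)) E ∧ (compatible a E ∧ not (crosses a a))
      ≡⟨ cong₂ _∧_ (trans (all-∧ (λ b → compatible b E) (λ b → not (crosses b a)) E)
                          (cong (pairwiseCompatible E ∧_) (all-cong E (λ b → cong not (crosses-sym b a)))))
                   (trans (cong (λ c → compatible a E ∧ not c) (crosses-irrefl a)) (∧-identityʳ _)) ⟩
    (pairwiseCompatible E ∧ compatible a E) ∧ compatible a E
      ≡⟨ ∧-absorb (pairwiseCompatible E) (compatible a E) ⟩
    pairwiseCompatible E ∧ compatible a E ∎
    where
    open ≡-Reasoning
    ∧-absorb : ∀ x y → (x ∧ y) ∧ y ≡ x ∧ y
    ∧-absorb x y = trans (∧-assoc x y y) (cong (x ∧_) (∧-idem y))

  module _ (n : ℕ) where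

    solid : Arc × Carrier → Bool
    solid = solidDiagonal M n

    solidArcs : List (Arc × Carrier) → List Arc
    solidArcs X = map proj₁ (filterᵇ solid X)

    all-solidArcs : ∀ P X → all P (solidArcs X) ≡ all (λ r → if solid r then P (proj₁ r) else true) X
    all-solidArcs P []      = refl
    all-solidArcs P (r ∷ X) with solid r
    ... | true  = cong (P (proj₁ r) ∧_) (all-solidArcs P X)
    ... | false = all-solidArcs P X

    isNoncrossing-pairwise : ∀ c → isNoncrossing M n c ≡ pairwiseCompatible (solidArcs (labelledArcs M n c))
    isNoncrossing-pairwise c = trans (all-cong X row) (sym (all-solidArcs (λ a → compatible a (solidArcs X)) X))
      where
      X : List (Arc × Carrier)
      X = labelledArcs M n c
      row : ∀ p → all (λ r → not (solid p ∧ solid r ∧ crosses (proj₁ p) (proj₁ r))) X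
                ≡ (if solid p then compatible (proj₁ p) (solidArcs X) else true)
      row p with solid p
      ... | true  = sym (trans (all-solidArcs (not ∘ crosses (proj₁ p)) X) (all-cong X (λ r → not-∧ (solid r) _)))
        where
        not-∧ : ∀ b c → (if b then not c else true) ≡ not (b ∧ c)
        not-∧ true  c = refl
        not-∧ false c = refl
      ... | false = all-true X

    -- the noncrossing test read left to right, E being the solid arcs met so far
    sequential : List Arc → List (Arc × Carrier) → Bool
    sequential E []            = true
    sequential E ((a , l) ∷ X) = if solid (a , l) then compatible a E ∧ sequential (E ∷ʳ a) X else sequential E X

    pairwiseCompatible-sequential : ∀ E X → pairwiseCompatible E ∧ sequential E X ≡ pairwiseCompatible (E ++ solidArcs X)
    pairwiseCompatible-sequential E [] = trans (∧-identityʳ _) (cong pairwiseCompatible (sym (++-identityʳ E)))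
    pairwiseCompatible-sequential E ((a , l) ∷ X) with solid (a , l)
    ... | true  = begin
      pairwiseCompatible E ∧ (compatible a E ∧ sequential (E ∷ʳ a) X)
        ≡⟨ sym (∧-assoc (pairwiseCompatible E) _ _) ⟩
      (pairwiseCompatible E ∧ compatible a E) ∧ sequential (E ∷ʳ a) X
        ≡⟨ cong (_∧ sequential (E ∷ʳ a) X) (sym (pairwiseCompatible-∷ʳ E a)) ⟩
      pairwiseCompatible (E ∷ʳ a) ∧ sequential (E ∷ʳ a) X
        ≡⟨ pairwiseCompatible-sequential (E ∷ʳ a) X ⟩
      pairwiseCompatible (E ∷ʳ a ++ solidArcs X)
        ≡⟨ cong pairwiseCompatible (++-assoc E [ a ] (solidArcs X)) ⟩
      pairwiseCompatible (E ++ a ∷ solidArcs X) ∎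
      where open ≡-Reasoning
    ... | false = pairwiseCompatible-sequential E X

    isNoncrossing-sequential : ∀ c → isNoncrossing M n c ≡ sequential [] (labelledArcs M n c)
    isNoncrossing-sequential c =
      trans (isNoncrossing-pairwise c) (sym (pairwiseCompatible-sequential [] (labelledArcs M n c)))

    labellings : List Arc → List Arc → ℕ
    labellings E L = length (filterᵇ (λ v → sequential E (zip L (Vec.toList v))) (allVecs M (length L)))

  labellings-∷ : ∀ n E a L → labellings n E (a ∷ L) ≡
    sum (map (λ c → if solid n (a , c) then χ (compatible a E) * labellings n (E ∷ʳ a) L else labellings n E L) elements)
  labellings-∷ n E a L =
    trans (length-filterᵇ-concatMap _ (λ c → map (c Vec.∷_) (allVecs M (length L))) elements)
          (cong sum (map-cong labelled-by elements))
    where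
    labelled-by : ∀ c → length (filterᵇ (λ v → sequential n E (zip (a ∷ L) (Vec.toList v))) (map (c Vec.∷_) (allVecs M (length L))))
                      ≡ (if solid n (a , c) then χ (compatible a E) * labellings n (E ∷ʳ a) L else labellings n E L)
    labelled-by c =
      trans (length-filterᵇ-map _ (c Vec.∷_) (allVecs M (length L)))
            (trans (length-filterᵇ-if (solid n (a , c)) _ _ (allVecs M (length L)))
                   (cong (λ k → if solid n (a , c) then k else labellings n E L)
                         (length-filterᵇ-∧ (compatible a E) _ (allVecs M (length L)))))

  length-elements : length elements ≡ card
  length-elements = trans (length-map (Inverse.from enumeration) (allFin card)) (length-tabulate (λ i → i))

  -- exactly one element of M is the unit
  sum-elements : ∀ d x y → sum (map (λ c → if d ∧ not (isUnit c) then x else y) elements) ≡ (if d then y + q * x else card * y)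
  sum-elements false x y = trans (sum-map-const elements y) (cong (_* y) length-elements)
  sum-elements true  x y = begin
    sum (map F (map (Inverse.from enumeration) (tabulate (λ i → i))))
      ≡⟨ cong sum (trans (sym (map-∘ (tabulate (λ i → i)))) (map-tabulate (λ i → i) (F ∘ Inverse.from enumeration))) ⟩
    sum (tabulate (F ∘ Inverse.from enumeration))
      ≡⟨ cong sum (tabulate-cong (λ i → cong (λ j → if not (does (j ≟Fin Inverse.to enumeration 𝟙)) then x else y)
                                             (Inverse.strictlyInverseˡ enumeration i))) ⟩
    sum (tabulate (λ i → if not (does (i ≟Fin Inverse.to enumeration 𝟙)) then x else y))
      ≡⟨ sum-tabulate-≟ card (Inverse.to enumeration 𝟙) x y ⟩
    y + q * x ∎
    where
    open ≡-Reasoning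
    F : Carrier → ℕ
    F c = if not (isUnit c) then x else y

  ¬diagonal⇒¬crosses : ∀ n a b → isDiagonal n a ≡ false → InPolygon 1 (suc n) b → crosses a b ≡ false
  ¬diagonal⇒¬crosses n (x , y) (x′ , y′) ¬diag (1≤x′ , _ , y′<)
    with T-⊎-of-not∧not≡false (y ≡ᵇ suc x) ((x ≡ᵇ 1) ∧ (y ≡ᵇ suc n)) ¬diag
  ... | inj₁ edge rewrite ≡ᵇ⇒≡ y (suc x) edge = edge⇒¬crosses x (x′ , y′)
  ... | inj₂ base with Equivalence.to T-∧ base
  ...   | x≡1 , y≡1+n rewrite ≡ᵇ⇒≡ x 1 x≡1 | ≡ᵇ⇒≡ y (suc n) y≡1+n =
    trans (crosses-sym (1 , suc n) (x′ , y′)) (nested⇒¬crosses 1≤x′ (≤-pred y′<))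

  labellings≡count : ∀ n E L → All (InPolygon 1 (suc n)) E → All (InPolygon 1 (suc n)) L → labellings n E L ≡ count E L
  labellings≡count n E []      _    _             = refl
  labellings≡count n E (a ∷ L) E-in (a-in ∷ L-in) =
    trans (labellings-∷ n E a L) (trans (sum-elements (isDiagonal n a) _ _) (by-kind (isDiagonal n a) refl))
    where
    by-kind : ∀ d → isDiagonal n a ≡ d →
      (if d then labellings n E L + q * (χ (compatible a E) * labellings n (E ∷ʳ a) L) else card * labellings n E L)
        ≡ count E (a ∷ L)
    by-kind true  _      =
      cong₂ _+_ (labellings≡count n E L E-in L-in)
            (trans (cong (λ v → q * (χ (compatible a E) * v)) (labellings≡count n (E ∷ʳ a) L (++⁺ E-in (a-in ∷ [])) L-in))
                   (sym (*-assoc q _ _)))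
    by-kind false ¬diag =
      trans (cong₂ _*_ card≡1+q (labellings≡count n E L E-in L-in))
            (sym (count-∷-free E a L (compatible-¬crosses a E (All.map (¬diagonal⇒¬crosses n a _ ¬diag) E-in))
                                     (All.map (λ {b} b-in → trans (crosses-sym b a) (¬diagonal⇒¬crosses n a b ¬diag b-in)) L-in)))

  applyUpTo-interval : ∀ (f : ℕ → ℕ) a k → (∀ i → f i ≡ a + i) → applyUpTo f k ≡ interval a k
  applyUpTo-interval f a zero    _  = refl
  applyUpTo-interval f a (suc k) eq =
    cong₂ _∷_ (trans (eq 0) (+-identityʳ a)) (applyUpTo-interval (f ∘ suc) (suc a) k (λ i → trans (eq (suc i)) (+-suc a i)))

  range-interval : ∀ a b → range a b ≡ interval a (suc b ∸ a)
  range-interval a b = trans (map-upTo (a +_) (suc b ∸ a)) (applyUpTo-interval (a +_) a (suc b ∸ a) (λ _ → refl))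

  concatMap-polygonArcs : ∀ a k b → a + k ≡ suc b → concatMap (λ x → map (x ,_) (range (suc x) b)) (interval a k) ≡ polygonArcs a k
  concatMap-polygonArcs a zero    b _      = refl
  concatMap-polygonArcs a (suc k) b a+k≡b =
    cong₂ _++_ (cong (map (a ,_)) (trans (range-interval (suc a) b) (cong (interval (suc a)) b∸a≡k)))
               (concatMap-polygonArcs (suc a) k b (trans (sym (+-suc a k)) a+k≡b))
    where
    b∸a≡k : b ∸ a ≡ k
    b∸a≡k = trans (cong (_∸ a) (sym (suc-injective (trans (sym (+-suc a k)) a+k≡b)))) (m+n∸m≡n a k)

  arcs-polygonArcs : ∀ n → arcs n ≡ polygonArcs 1 (suc n)
  arcs-polygonArcs n = trans (cong (concatMap _) (range-interval 1 (suc n))) (concatMap-polygonArcs 1 (suc n) (suc n) refl)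

  dimNC-polygonCount : ∀ p → dimNC M (2 + p) ≡ polygonCount (3 + p)
  dimNC-polygonCount p = begin
    length (filterᵇ (isNoncrossing M n) (allVecs M (length (arcs n))))
      ≡⟨ cong length (filter-≐ (T? ∘ isNoncrossing M n) (T? ∘ (λ v → sequential n [] (zip (arcs n) (Vec.toList v))))
                              ((λ {v} → subst T (isNoncrossing-sequential n v)) , (λ {v} → subst T (sym (isNoncrossing-sequential n v))))
                              (allVecs M (length (arcs n)))) ⟩
    labellings n [] (arcs n)
      ≡⟨ labellings≡count n [] (arcs n) [] arcs-inPolygon ⟩
    count [] (arcs n)
      ≡⟨ cong (count []) (arcs-polygonArcs n) ⟩
    count [] (polygonArcs 1 (suc n))
      ≡⟨ count-polygonArcs 1 (suc n) ⟩
    polygonCount (suc n) ∎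
    where
    open ≡-Reasoning
    n : ℕ
    n = 2 + p
    arcs-inPolygon : All (InPolygon 1 (suc n)) (arcs n)
    arcs-inPolygon = subst (All (InPolygon 1 (suc n))) (sym (arcs-polygonArcs n)) (polygonArcs-inPolygon 1 (suc n))

module HilbertSeries (M : FiniteUnitaryMagma) where
  open import Data.Nat as ℕ using (zero; suc; _∸_; _<_; s<s)
  import Data.Nat.Properties as ℕ
  open import Data.Integer using (ℤ; +_; _+_; _-_; _*_)
  open import Data.Integer.Tactic.RingSolver using (solve-∀)
  open FiniteUnitaryMagma M using (card)
  open Labellings M using (q; card≡1+q; dimNC-polygonCount)
  open Noncrossing.PolygonCount q using (polygonCount; polygonCount-two)
  open PolygonRecurrence q using (polygonCount-recurrence)
  open Coefficients using (sumBelow; sumBelow-suc; sumBelow-cong; ⊛-sumBelow; β)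

  H : PowerSeries
  H = hilbertSeries M

  m : ℤ
  m = + card

  A : ℕ → ℤ
  A k = + polygonCount k

  1+q≡m : + suc q ≡ m
  1+q≡m = cong +_ (sym card≡1+q)

  q≡m-1 : + q ≡ m - + 1
  q≡m-1 = sym (cong (λ c → + c - + 1) card≡1+q)

  H≡A : ∀ k → H (2 ℕ.+ k) ≡ A (3 ℕ.+ k)
  H≡A k = cong +_ (dimNC-polygonCount k)

  H∸≡A∸ : ∀ p i → i < p → H (suc p ∸ i) ≡ A (suc (suc p ∸ i))
  H∸≡A∸ (suc p) zero    _         = H≡A p
  H∸≡A∸ (suc p) (suc i) (s<s i<p) = H∸≡A∸ p i i<p

  A₂ : A 2 ≡ m
  A₂ = trans (cong +_ polygonCount-two) 1+q≡m

  polygonCount-recurrence-m : ∀ j → A (2 ℕ.+ j) ≡ m * A (suc j) + (m - + 1) * sumBelow (λ i → A (2 ℕ.+ i) * A (suc (j ∸ i))) j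
  polygonCount-recurrence-m j =
    trans (polygonCount-recurrence j) (cong₂ (λ a b → a * A (suc j) + b * sumBelow (λ i → A (2 ℕ.+ i) * A (suc (j ∸ i))) j) 1+q≡m q≡m-1)

  hilbert-two : H 2 ≡ m * m * m
  hilbert-two = begin
    H 2                                       ≡⟨ H≡A 0 ⟩
    A 3                                       ≡⟨ polygonCount-recurrence-m 1 ⟩
    m * A 2 + (m - + 1) * (A 2 * A 2 + + 0)   ≡⟨ cong (λ a → m * a + (m - + 1) * (a * a + + 0)) A₂ ⟩
    m * m + (m - + 1) * (m * m + + 0)         ≡⟨ cube m ⟩
    m * m * m                                 ∎
    where
    open ≡-Reasoning
    cube : ∀ m → m * m + (m - + 1) * (m * m + + 0) ≡ m * m * m
    cube = solve-∀

  middle : ℕ → ℤ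
  middle p = sumBelow (λ i → H (2 ℕ.+ i) * H (suc p ∸ i)) p

  H⊛H : ∀ p → (H ⊛ H) (3 ℕ.+ p) ≡ + 2 * H (2 ℕ.+ p) + middle p
  H⊛H p = begin
    (H ⊛ H) (3 ℕ.+ p)
      ≡⟨ ⊛-sumBelow H H (3 ℕ.+ p) ⟩
    + 0 * H (3 ℕ.+ p) + (+ 1 * H (2 ℕ.+ p) + sumBelow g (2 ℕ.+ p))
      ≡⟨ cong (λ s → + 0 * H (3 ℕ.+ p) + (+ 1 * H (2 ℕ.+ p) + s))
              (trans (sumBelow-suc g (suc p)) (cong (_+ g (suc p)) (sumBelow-suc g p))) ⟩
    + 0 * H (3 ℕ.+ p) + (+ 1 * H (2 ℕ.+ p) + (middle p + H (2 ℕ.+ p) * H (suc p ∸ p) + H (3 ℕ.+ p) * H (p ∸ p)))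
      ≡⟨ cong₂ (λ i j → + 0 * H (3 ℕ.+ p) + (+ 1 * H (2 ℕ.+ p) + (middle p + H (2 ℕ.+ p) * H i + H (3 ℕ.+ p) * H j)))
               (ℕ.m+n∸n≡m 1 p) (ℕ.n∸n≡0 p) ⟩
    + 0 * H (3 ℕ.+ p) + (+ 1 * H (2 ℕ.+ p) + (middle p + H (2 ℕ.+ p) * + 1 + H (3 ℕ.+ p) * + 0))
      ≡⟨ collect (H (3 ℕ.+ p)) (H (2 ℕ.+ p)) (middle p) ⟩
    + 2 * H (2 ℕ.+ p) + middle p ∎
    where
    open ≡-Reasoning
    g : ℕ → ℤ
    g i = H (2 ℕ.+ i) * H (suc p ∸ i)
    collect : ∀ h₃ h₂ s → + 0 * h₃ + (+ 1 * h₂ + (s + h₂ * + 1 + h₃ * + 0)) ≡ + 2 * h₂ + s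
    collect = solve-∀

  H-unrolled : ∀ p → H (3 ℕ.+ p) ≡ m * H (2 ℕ.+ p) + (m - + 1) * (+ 2 * m * H (2 ℕ.+ p) + middle p)
  H-unrolled p = begin
    H (3 ℕ.+ p)
      ≡⟨ H≡A (suc p) ⟩
    A (4 ℕ.+ p)
      ≡⟨ polygonCount-recurrence-m (2 ℕ.+ p) ⟩
    m * A (3 ℕ.+ p) + (m - + 1) * (A 2 * A (3 ℕ.+ p) + sumBelow f (suc p))
      ≡⟨ cong (λ s → m * A (3 ℕ.+ p) + (m - + 1) * (A 2 * A (3 ℕ.+ p) + s)) (sumBelow-suc f p) ⟩
    m * A (3 ℕ.+ p) + (m - + 1) * (A 2 * A (3 ℕ.+ p) + (sumBelow f p + A (3 ℕ.+ p) * A (suc (suc p ∸ p))))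
      ≡⟨ cong₂ (λ s a → m * A (3 ℕ.+ p) + (m - + 1) * (A 2 * A (3 ℕ.+ p) + (s + A (3 ℕ.+ p) * a)))
               (sumBelow-cong p (λ i i<p → sym (cong₂ _*_ (H≡A i) (H∸≡A∸ p i i<p))))
               (cong (λ k → A (suc k)) (ℕ.m+n∸n≡m 1 p)) ⟩
    m * A (3 ℕ.+ p) + (m - + 1) * (A 2 * A (3 ℕ.+ p) + (middle p + A (3 ℕ.+ p) * A 2))
      ≡⟨ cong₂ (λ a h → m * h + (m - + 1) * (a * h + (middle p + h * a))) A₂ (sym (H≡A p)) ⟩
    m * H (2 ℕ.+ p) + (m - + 1) * (m * H (2 ℕ.+ p) + (middle p + H (2 ℕ.+ p) * m))
      ≡⟨ collect m (H (2 ℕ.+ p)) (middle p) ⟩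
    m * H (2 ℕ.+ p) + (m - + 1) * (+ 2 * m * H (2 ℕ.+ p) + middle p) ∎
    where
    open ≡-Reasoning
    f : ℕ → ℤ
    f i = A (3 ℕ.+ i) * A (suc (suc p ∸ i))
    collect : ∀ m h s → m * h + (m - + 1) * (m * h + (s + h * m)) ≡ m * h + (m - + 1) * (+ 2 * m * h + s)
    collect = solve-∀

  hilbert-recurrence : ∀ p → H (3 ℕ.+ p) ≡ β m * H (2 ℕ.+ p) + (m - + 1) * (H ⊛ H) (3 ℕ.+ p)
  hilbert-recurrence p =
    trans (H-unrolled p) (trans (regroup m (H (2 ℕ.+ p)) (middle p)) (cong (λ c → β m * H (2 ℕ.+ p) + (m - + 1) * c) (sym (H⊛H p))))
    where
    regroup : ∀ m h s → m * h + (m - + 1) * (+ 2 * m * h + s) ≡ (+ 2 * m * m - + 3 * m + + 2) * h + (m - + 1) * (+ 2 * h + s)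
    regroup = solve-∀

open import Data.Integer using (ℤ; +_; _+_; _-_; _*_; -_)

proposition3p6 : (M : FiniteUnitaryMagma) →
    let m = + FiniteUnitaryMagma.card M
        H = hilbertSeries M
    in ∀ (n : ℕ) →
       (t
        ⊕ const (m * m * m - + 2 * m * m + + 2 * m - + 1) ⊛ t ⊛ t
        ⊕ (const (+ 2 * m * m - + 3 * m + + 2) ⊛ t ⊕ const (- + 1)) ⊛ H
        ⊕ const (m - + 1) ⊛ H ⊛ H) n
       ≡ + 0
proposition3p6 M = functionalEquation-vanishes m H refl refl hilbert-two hilbert-recurrence
  where
  open Coefficients using (functionalEquation-vanishes)
  open HilbertSeries M using (m; H; hilbert-two; hilbert-recurrence)
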